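{- Let $k\ge1$, $n=3^k$, $f=\mathrm{Maj}_3^{\circ k}\colon\mathbb F_2^n\to\{+1,-1\}$, and let $S\subseteq[n]$. Let $V_S=\mathrm{span}\{e_i:i\in S\}\le\mathbb F_2^n$, where $e_i$ are the standard unit vectors. Then $$\sum_{Z\in V_S}\hat f(Z)^2\le\frac{|S|}{n}.$$
   Context: Boolean values are written as $\pm1$ (bit $0\mapsto+1$, bit $1\mapsto-1$); $\mathrm{Maj}_3\colon\mathbb F_2^3\to\{+1,-1\}$ is majority of three bits, $\mathrm{Maj}_3=\frac12(\chi_{\{1\}}+\chi_{\{2\}}+\chi_{\{3\}}-\chi_{\{1,2,3\}})$ with $\chi_S(x)=(-1)^{\sum_{i\in S}x_i}$. Composition $(f\circ g)(x)=f(g(x_1,\dots,x_m),\dots,g(x_{m(a-1)+1},\dots,x_{ma}))$ for $f$ on $a$ bits and $g$ on $m$ bits; $\mathrm{Maj}_3^{\circ1}=\mathrm{Maj}_3$, $\mathrm{Maj}_3^{\circ k}=\mathrm{Maj}_3\circ\mathrm{Maj}_3^{\circ(k-1)}$. $\hat f(Z)=\mathbb E_{x\sim U(\mathbb F_2^n)}[f(x)(-1)^{Z\cdot x}]$. -}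

module Defs where

open import Data.Bool using (Bool; true; false; _xor_; _∧_; if_then_else_)
open import Data.Nat using (ℕ; zero; suc; _^_)
open import Data.Nat.Properties using (m^n≢0)
open import Data.Integer using (ℤ; +_; -_)
import Data.Integer as ℤ
open import Data.Rational using (ℚ; _/_)
import Data.Rational as ℚ
open import Data.Vec using (Vec; []; _∷_; take; drop; zipWith; foldr)
open import Data.List using (List; []; _∷_; map; _++_; filter)
import Data.List as List
open import Data.Product using (_,_)
open import Data.Fin.Subset using (Subset; _⊆_; ∣_∣)
open import Data.Fin.Subset.Properties using (_⊆?_)

-- Bits: false = bit 0 (value +1), true = bit 1 (value -1).

maj3 : Bool → Bool → Bool → Bool
maj3 a b c = (a ∧ b) xor ((b ∧ c) xor (a ∧ c))

-- Maj₃^{∘k} on 3^k bits; k = 0 is the identity on one bit.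
-- 3 ^ suc k reduces to 3^k + (3^k + (3^k + 0)); blocks are consecutive.
majIter : (k : ℕ) → Vec Bool (3 ^ k) → Bool
majIter zero (b ∷ []) = b
majIter (suc k) x =
  let x₁ = take (3 ^ k) x
      r  = drop (3 ^ k) x
      x₂ = take (3 ^ k) r
      x₃ = take (3 ^ k) (drop (3 ^ k) r)
  in maj3 (majIter k x₁) (majIter k x₂) (majIter k x₃)

sign : Bool → ℤ
sign false = + 1
sign true  = - (+ 1)

allVecs : (n : ℕ) → List (Vec Bool n)
allVecs zero = [] ∷ []
allVecs (suc n) = map (false ∷_) (allVecs n) ++ map (true ∷_) (allVecs n)

dot : ∀ {n} → Vec Bool n → Vec Bool n → Bool
dot Z x = foldr _ _xor_ false (zipWith _∧_ Z x)

χ : ∀ {n} → Vec Bool n → Vec Bool n → ℤ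
χ Z x = sign (dot Z x)

fourier : ∀ {n} → (Vec Bool n → Bool) → Vec Bool n → ℚ
fourier {n} f Z =
  (List.foldr ℤ._+_ (+ 0) (map (λ x → sign (f x) ℤ.* χ Z x) (allVecs n)))
    / (2 ^ n) where instance _ = m^n≢0 2 n

-- V_S = span{e_i : i ∈ S} = vectors Z (identified with their support) with Z ⊆ S
V : ∀ {n} → Subset n → List (Vec Bool n)
V {n} S = filter (λ Z → Z ⊆? S) (allVecs n)

sumℚ : List ℚ → ℚ
sumℚ = List.foldr ℚ._+_ ℚ.0ℚ

ratio : (k : ℕ) → Subset (3 ^ k) → ℚ
ratio k S = (+ ∣ S ∣) / (3 ^ k) where instance _ = m^n≢0 3 k

-- Write M_S(u, v) = Σ_{Z ⊆ S} û(Z) v̂(Z) for u, v : 𝔽₂ⁿ → ℤ, so that the left-hand side of the theorem is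
-- M_S(f, f). This form is bilinear, it is multiplicative on tensor products (characters and the condition
-- Z ⊆ S factor over blocks of coordinates), and a balanced function is orthogonal to the constants under
-- it. Expanding 2·Maj₃(g₁, g₂, g₃) = g₁ (1 − g₂ g₃) + (g₂ + g₃) with g = Maj₃^{∘(k−1)} balanced, the mass
-- ρ of f on S = S₁S₂S₃ and the masses ρᵢ of g on the blocks satisfy 4ρ = ρ₁ + ρ₂ + ρ₃ + ρ₁ρ₂ρ₃.
-- By induction ρᵢ ≤ |Sᵢ|/m ≤ 1 (m = 3^{k−1}), hence 3ρ₁ρ₂ρ₃ ≤ ρ₁ + ρ₂ + ρ₃ and ρ ≤ |S|/(3m).

module Submission where

open import Defs
open import Data.Nat using (ℕ; _≤_; _^_)
open import Data.Fin.Subset using (Subset)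
open import Data.List using (map)
import Data.Rational as ℚ

open import Data.Bool using (Bool; true; false; _xor_; _∧_; not; if_then_else_)
open import Data.Nat as ℕ using (zero; suc; NonZero)
import Data.Nat.Properties as ℕP
import Data.List.Properties as ListP
open import Data.Vec using (Vec; []; _∷_; take; drop)
open import Data.List as List using (List; []; _∷_; filter; _++_)
open import Data.Sum using (_⊎_; inj₁; inj₂)
open import Data.Fin.Subset using (inside; outside; ∣_∣) renaming (⊥ to ∅)
open import Data.Fin.Subset.Properties using (_⊆?_; ∣p∣≤n)
open import Data.Rational using (toℚᵘ)
import Data.Rational.Properties as ℚP
open import Data.Rational.Unnormalised as ℚᵘ using (mkℚᵘ; _≃_; *≡*; *≤*)
import Data.Rational.Unnormalised.Properties as ℚᵘP
open import Function using (_∘_)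
open import Relation.Nullary using (does)
open import Relation.Unary using (Pred; Decidable)
open import Relation.Binary.PropositionalEquality

module Arithmetic where

  open import Data.Nat using (_+_; _*_)
  open import Data.Nat.Properties
  open import Data.Nat.Tactic.RingSolver using (solve-∀)

  triple-product-bound : ∀ {w a b c} → a ≤ w → b ≤ w → c ≤ w → 3 * (a * b * c) ≤ w * w * (a + b + c)
  triple-product-bound {w} {a} {b} {c} a≤w b≤w c≤w = begin
    3 * (a * b * c)                          ≡⟨ spread a b c ⟩
    a * (b * c) + b * (a * c) + c * (a * b)  ≤⟨ +-mono-≤ (+-mono-≤ (*-monoʳ-≤ a (*-mono-≤ b≤w c≤w))
                                                                  (*-monoʳ-≤ b (*-mono-≤ a≤w c≤w)))
                                                         (*-monoʳ-≤ c (*-mono-≤ a≤w b≤w)) ⟩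
    a * (w * w) + b * (w * w) + c * (w * w)  ≡⟨ factor a b c w ⟩
    w * w * (a + b + c)                      ∎
    where
    open ≤-Reasoning
    spread : ∀ a b c → 3 * (a * b * c) ≡ a * (b * c) + b * (a * c) + c * (a * b)
    spread = solve-∀
    factor : ∀ a b c w → a * (w * w) + b * (w * w) + c * (w * w) ≡ w * w * (a + b + c)
    factor = solve-∀

  majority-step-bound : ∀ m .{{_ : NonZero m}} {p p₁ p₂ p₃ s₁ s₂ s₃ w} →
                        4 * p ≡ p₁ * (p₂ * p₃ + w * w) + w * (p₂ * w + w * p₃) →
                        m * p₁ ≤ s₁ * w → m * p₂ ≤ s₂ * w → m * p₃ ≤ s₃ * w →
                        s₁ ≤ m → s₂ ≤ m → s₃ ≤ m →
                        3 * m * p ≤ (s₁ + (s₂ + s₃)) * (w * (w * w))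
  majority-step-bound m {p} {p₁} {p₂} {p₃} {s₁} {s₂} {s₃} {w} recursion mp₁≤ mp₂≤ mp₃≤ s₁≤m s₂≤m s₃≤m =
    *-cancelˡ-≤ 4 (begin
      4 * (3 * m * p)                                                  ≡⟨ swap-4 m p ⟩
      3 * m * (4 * p)                                                  ≡⟨ cong (3 * m *_) recursion ⟩
      3 * m * (p₁ * (p₂ * p₃ + w * w) + w * (p₂ * w + w * p₃))         ≡⟨ expand m p₁ p₂ p₃ w ⟩
      m * (3 * (p₁ * p₂ * p₃)) + 3 * m * (w * w * (p₁ + p₂ + p₃))      ≤⟨ +-monoˡ-≤ _ (*-monoʳ-≤ m
           (triple-product-bound (≤w mp₁≤ s₁≤m) (≤w mp₂≤ s₂≤m) (≤w mp₃≤ s₃≤m))) ⟩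
      m * (w * w * (p₁ + p₂ + p₃)) + 3 * m * (w * w * (p₁ + p₂ + p₃))  ≡⟨ collect m p₁ p₂ p₃ w ⟩
      4 * (w * w * (m * p₁ + m * p₂ + m * p₃))                         ≤⟨ *-monoʳ-≤ 4 (*-monoʳ-≤ (w * w)
           (+-mono-≤ (+-mono-≤ mp₁≤ mp₂≤) mp₃≤)) ⟩
      4 * (w * w * (s₁ * w + s₂ * w + s₃ * w))                         ≡⟨ factor s₁ s₂ s₃ w ⟩
      4 * ((s₁ + (s₂ + s₃)) * (w * (w * w)))                           ∎)
    where
    open ≤-Reasoning
    ≤w : ∀ {pᵢ sᵢ} → m * pᵢ ≤ sᵢ * w → sᵢ ≤ m → pᵢ ≤ w
    ≤w mpᵢ≤ sᵢ≤m = *-cancelˡ-≤ m (≤-trans mpᵢ≤ (*-monoˡ-≤ w sᵢ≤m))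
    swap-4 : ∀ m p → 4 * (3 * m * p) ≡ 3 * m * (4 * p)
    swap-4 = solve-∀
    expand : ∀ m p₁ p₂ p₃ w → 3 * m * (p₁ * (p₂ * p₃ + w * w) + w * (p₂ * w + w * p₃))
                              ≡ m * (3 * (p₁ * p₂ * p₃)) + 3 * m * (w * w * (p₁ + p₂ + p₃))
    expand = solve-∀
    collect : ∀ m p₁ p₂ p₃ w → m * (w * w * (p₁ + p₂ + p₃)) + 3 * m * (w * w * (p₁ + p₂ + p₃))
                               ≡ 4 * (w * w * (m * p₁ + m * p₂ + m * p₃))
    collect = solve-∀
    factor : ∀ s₁ s₂ s₃ w → 4 * (w * w * (s₁ * w + s₂ * w + s₃ * w)) ≡ 4 * ((s₁ + (s₂ + s₃)) * (w * (w * w)))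
    factor = solve-∀

  ^-cube : ∀ b m → b ^ (m + (m + (m + 0))) ≡ b ^ m * (b ^ m * b ^ m)
  ^-cube b m = begin
    b ^ (m + (m + (m + 0)))        ≡⟨ ^-distribˡ-+-* b m _ ⟩
    b ^ m * b ^ (m + (m + 0))      ≡⟨ cong (b ^ m *_) (^-distribˡ-+-* b m _) ⟩
    b ^ m * (b ^ m * b ^ (m + 0))  ≡⟨ cong (λ e → b ^ m * (b ^ m * b ^ e)) (+-identityʳ m) ⟩
    b ^ m * (b ^ m * b ^ m)        ∎
    where open ≡-Reasoning

  4^n≡2^n*2^n : ∀ n → 4 ^ n ≡ 2 ^ n * 2 ^ n
  4^n≡2^n*2^n zero    = refl
  4^n≡2^n*2^n (suc n) = trans (cong (4 *_) (4^n≡2^n*2^n n)) (regroup (2 ^ n))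
    where
    regroup : ∀ a → 4 * (a * a) ≡ 2 * a * (2 * a)
    regroup = solve-∀

open Arithmetic

open import Data.Integer as ℤ using (ℤ; +_; _+_; _-_; _*_; -1ℤ)
import Data.Integer.Properties as ℤP
open import Data.Integer.Tactic.RingSolver using (solve-∀)

-- Sums over the Boolean cube

Fun : ℕ → Set
Fun n = Vec Bool n → ℤ

∑ : (n : ℕ) → Fun n → ℤ
∑ zero    f = f []
∑ (suc n) f = ∑ n (λ x → f (false ∷ x)) + ∑ n (λ x → f (true ∷ x))

∑-cong : ∀ n {f g : Fun n} → (∀ x → f x ≡ g x) → ∑ n f ≡ ∑ n g
∑-cong zero    f≗g = f≗g []
∑-cong (suc n) f≗g = cong₂ _+_ (∑-cong n (f≗g ∘ (false ∷_))) (∑-cong n (f≗g ∘ (true ∷_)))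

∑-+ : ∀ n (f g : Fun n) → ∑ n (λ x → f x + g x) ≡ ∑ n f + ∑ n g
∑-+ zero    f g = refl
∑-+ (suc n) f g =
  trans (cong₂ _+_ (∑-+ n (f ∘ (false ∷_)) (g ∘ (false ∷_))) (∑-+ n (f ∘ (true ∷_)) (g ∘ (true ∷_))))
        (+-interchange (∑ n (f ∘ (false ∷_))) _ _ _)
  where
  +-interchange : ∀ a b c d → (a + b) + (c + d) ≡ (a + c) + (b + d)
  +-interchange = solve-∀

∑-*ˡ : ∀ n c (f : Fun n) → ∑ n (λ x → c * f x) ≡ c * ∑ n f
∑-*ˡ zero    c f = refl
∑-*ˡ (suc n) c f = trans (cong₂ _+_ (∑-*ˡ n c _) (∑-*ˡ n c _)) (sym (ℤP.*-distribˡ-+ c _ _))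

∑-*ʳ : ∀ n c (f : Fun n) → ∑ n (λ x → f x * c) ≡ ∑ n f * c
∑-*ʳ n c f = trans (∑-cong n (λ x → ℤP.*-comm (f x) c)) (trans (∑-*ˡ n c f) (ℤP.*-comm c _))

∑-zero : ∀ n → ∑ n (λ _ → + 0) ≡ + 0
∑-zero zero    = refl
∑-zero (suc n) = cong₂ _+_ (∑-zero n) (∑-zero n)

∑-nonneg : ∀ n (f : Fun n) → (∀ x → + 0 ℤ.≤ f x) → + 0 ℤ.≤ ∑ n f
∑-nonneg zero    f f≥0 = f≥0 []
∑-nonneg (suc n) f f≥0 = ℤP.+-mono-≤ (∑-nonneg n _ (f≥0 ∘ (false ∷_))) (∑-nonneg n _ (f≥0 ∘ (true ∷_)))

∑-split : ∀ a b (h : Vec Bool a → Vec Bool b → ℤ) →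
          ∑ (a ℕ.+ b) (λ x → h (take a x) (drop a x)) ≡ ∑ a (λ y → ∑ b (h y))
∑-split zero    b h = refl
∑-split (suc a) b h = cong₂ _+_ (∑-split a b (λ y → h (false ∷ y))) (∑-split a b (λ y → h (true ∷ y)))

infixr 7 _⊗_
_⊗_ : ∀ {a b} → Fun a → Fun b → Fun (a ℕ.+ b)
_⊗_ {a} u v x = u (take a x) * v (drop a x)

∑-⊗ : ∀ {a b} (u : Fun a) (v : Fun b) → ∑ (a ℕ.+ b) (u ⊗ v) ≡ ∑ a u * ∑ b v
∑-⊗ {a} {b} u v = begin
  ∑ (a ℕ.+ b) (u ⊗ v)            ≡⟨ ∑-split a b (λ y z → u y * v z) ⟩
  ∑ a (λ y → ∑ b (λ z → u y * v z)) ≡⟨ ∑-cong a (λ y → ∑-*ˡ b (u y) v) ⟩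
  ∑ a (λ y → u y * ∑ b v)         ≡⟨ ∑-*ʳ a (∑ b v) u ⟩
  ∑ a u * ∑ b v                   ∎
  where open ≡-Reasoning

∑-⊗-zeroˡ : ∀ {a b} (u : Fun a) (v : Fun b) → ∑ a u ≡ + 0 → ∑ (a ℕ.+ b) (u ⊗ v) ≡ + 0
∑-⊗-zeroˡ {b = b} u v ∑u≡0 = trans (∑-⊗ u v) (trans (cong (_* ∑ b v) ∑u≡0) (ℤP.*-zeroˡ (∑ b v)))

∑-⊗-zeroʳ : ∀ {a b} (u : Fun a) (v : Fun b) → ∑ b v ≡ + 0 → ∑ (a ℕ.+ b) (u ⊗ v) ≡ + 0
∑-⊗-zeroʳ {a} u v ∑v≡0 = trans (∑-⊗ u v) (trans (cong (∑ a u *_) ∑v≡0) (ℤP.*-zeroʳ (∑ a u)))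

one : ∀ {n} → Fun n
one _ = + 1

infixl 6 _+ᶠ_
_+ᶠ_ : ∀ {n} → Fun n → Fun n → Fun n
(u +ᶠ v) x = u x + v x

infixr 8 _·ᶠ_
_·ᶠ_ : ∀ {n} → ℤ → Fun n → Fun n
(c ·ᶠ u) x = c * u x

-- Characters

sign-xor : ∀ a b → sign (a xor b) ≡ sign a * sign b
sign-xor false b     = sym (ℤP.*-identityˡ (sign b))
sign-xor true  false = refl
sign-xor true  true  = refl

χ-∷ : ∀ {n} z c (Z x : Vec Bool n) → χ (z ∷ Z) (c ∷ x) ≡ sign (z ∧ c) * χ Z x
χ-∷ z c Z x = sign-xor (z ∧ c) (dot Z x)

χ-split : ∀ a {b} (Z x : Vec Bool (a ℕ.+ b)) →
          χ Z x ≡ χ (take a Z) (take a x) * χ (drop a Z) (drop a x)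
χ-split zero    Z       x       = sym (ℤP.*-identityˡ (χ Z x))
χ-split (suc a) (z ∷ Z) (c ∷ x) = begin
  χ (z ∷ Z) (c ∷ x)                                          ≡⟨ χ-∷ z c Z x ⟩
  sign (z ∧ c) * χ Z x                                        ≡⟨ cong (sign (z ∧ c) *_) (χ-split a Z x) ⟩
  sign (z ∧ c) * (χ (take a Z) (take a x) * χ (drop a Z) (drop a x))
    ≡⟨ sym (ℤP.*-assoc (sign (z ∧ c)) _ _) ⟩
  sign (z ∧ c) * χ (take a Z) (take a x) * χ (drop a Z) (drop a x)
    ≡⟨ cong (_* χ (drop a Z) (drop a x)) (sym (χ-∷ z c (take a Z) (take a x))) ⟩
  χ (z ∷ take a Z) (c ∷ take a x) * χ (drop a Z) (drop a x)  ∎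
  where open ≡-Reasoning

χ-∅ : ∀ {n} (x : Vec Bool n) → χ ∅ x ≡ + 1
χ-∅ []      = refl
χ-∅ (_ ∷ x) = χ-∅ x

∑-χ : ∀ {n} (Z : Vec Bool n) → Z ≡ ∅ ⊎ ∑ n (χ Z) ≡ + 0
∑-χ []          = inj₁ refl
∑-χ {suc n} (false ∷ Z) with ∑-χ Z
... | inj₁ Z≡∅  = inj₁ (cong (false ∷_) Z≡∅)
... | inj₂ ∑≡0  = inj₂ (cong₂ _+_ ∑≡0 ∑≡0)
∑-χ {suc n} (true ∷ Z) = inj₂ (trans (sym (∑-+ n (χ Z) (sign ∘ not ∘ dot Z)))
                                    (trans (∑-cong n (λ x → sign-not (dot Z x))) (∑-zero n)))
  where
  sign-not : ∀ b → sign b + sign (not b) ≡ + 0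
  sign-not false = refl
  sign-not true  = refl

-- Restricted Fourier mass

-- transform u Z = 2ⁿ û(Z) and mass S u v = 4ⁿ M_S(u, v): unnormalised, so that all of the algebra is in ℤ.
transform : ∀ {n} → Fun n → Vec Bool n → ℤ
transform {n} u Z = ∑ n (λ x → u x * χ Z x)

indicator : Bool → ℤ
indicator b = if b then + 1 else + 0

[_⊆_] : ∀ {n} → Subset n → Subset n → ℤ
[ Z ⊆ S ] = indicator (does (Z ⊆? S))

mass : ∀ {n} → Subset n → Fun n → Fun n → ℤ
mass {n} S u v = ∑ n (λ Z → [ Z ⊆ S ] * (transform u Z * transform v Z))

transform-cong : ∀ {n} {u v : Fun n} → (∀ x → u x ≡ v x) → ∀ Z → transform u Z ≡ transform v Z
transform-cong {n} u≗v Z = ∑-cong n (λ x → cong (_* χ Z x) (u≗v x))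

transform-+ : ∀ {n} (u v : Fun n) Z → transform (u +ᶠ v) Z ≡ transform u Z + transform v Z
transform-+ {n} u v Z = trans (∑-cong n (λ x → ℤP.*-distribʳ-+ (χ Z x) (u x) (v x)))
                              (∑-+ n (λ x → u x * χ Z x) (λ x → v x * χ Z x))

transform-· : ∀ {n} c (u : Fun n) Z → transform (c ·ᶠ u) Z ≡ c * transform u Z
transform-· {n} c u Z = trans (∑-cong n (λ x → ℤP.*-assoc c (u x) (χ Z x))) (∑-*ˡ n c (λ x → u x * χ Z x))

transform-⊗ : ∀ {a b} (u : Fun a) (v : Fun b) Z →
              transform (u ⊗ v) Z ≡ transform u (take a Z) * transform v (drop a Z)
transform-⊗ {a} {b} u v Z = trans (∑-cong (a ℕ.+ b) regroup) (∑-⊗ (λ y → u y * χ Z₁ y) (λ y → v y * χ Z₂ y))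
  where
  Z₁ = take a Z
  Z₂ = drop a Z
  regroup : ∀ x → (u ⊗ v) x * χ Z x ≡ (u (take a x) * χ Z₁ (take a x)) * (v (drop a x) * χ Z₂ (drop a x))
  regroup x = trans (cong ((u ⊗ v) x *_) (χ-split a Z x))
                      (interchange (u (take a x)) (v (drop a x)) (χ Z₁ (take a x)) (χ Z₂ (drop a x)))
    where
    interchange : ∀ p q r s → p * q * (r * s) ≡ p * r * (q * s)
    interchange = solve-∀

⊆-split : ∀ a {b} (Z S : Subset (a ℕ.+ b)) →
          [ Z ⊆ S ] ≡
          [ take a Z ⊆ take a S ] * [ drop a Z ⊆ drop a S ]
⊆-split zero    Z                 S                = sym (ℤP.*-identityˡ _)
⊆-split (suc a) (outside ∷ Z)     (_ ∷ S)          = ⊆-split a Z S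
⊆-split (suc a) (inside ∷ Z)      (inside ∷ S)     = ⊆-split a Z S
⊆-split (suc a) (inside ∷ Z)      (outside ∷ S)    = refl

mass-⊗ : ∀ {a b} (S : Subset (a ℕ.+ b)) (u v : Fun a) (u′ v′ : Fun b) →
         mass S (u ⊗ u′) (v ⊗ v′) ≡ mass (take a S) u v * mass (drop a S) u′ v′
mass-⊗ {a} {b} S u v u′ v′ = trans (∑-cong (a ℕ.+ b) regroup)
  (∑-⊗ (λ Z → [ Z ⊆ take a S ] * (transform u Z * transform v Z))
       (λ Z → [ Z ⊆ drop a S ] * (transform u′ Z * transform v′ Z)))
  where
  regroup : ∀ Z → [ Z ⊆ S ] * (transform (u ⊗ u′) Z * transform (v ⊗ v′) Z) ≡
            ([ take a Z ⊆ take a S ] * (transform u (take a Z) * transform v (take a Z))) *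
            ([ drop a Z ⊆ drop a S ] * (transform u′ (drop a Z) * transform v′ (drop a Z)))
  regroup Z rewrite ⊆-split a Z S | transform-⊗ u u′ Z | transform-⊗ v v′ Z =
    shuffle [ take a Z ⊆ take a S ] [ drop a Z ⊆ drop a S ]
            (transform u (take a Z)) (transform v (take a Z)) (transform u′ (drop a Z)) (transform v′ (drop a Z))
    where
    shuffle : ∀ i j p q r s → i * j * (p * r * (q * s)) ≡ i * (p * q) * (j * (r * s))
    shuffle = solve-∀

module _ {n} (S : Subset n) where

  mass-cong : ∀ {u u′ v v′ : Fun n} → (∀ x → u x ≡ u′ x) → (∀ x → v x ≡ v′ x) → mass S u v ≡ mass S u′ v′
  mass-cong u≗u′ v≗v′ =
    ∑-cong n (λ Z → cong ([ Z ⊆ S ] *_) (cong₂ _*_ (transform-cong u≗u′ Z) (transform-cong v≗v′ Z)))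

  mass-comm : ∀ u v → mass S u v ≡ mass S v u
  mass-comm u v = ∑-cong n (λ Z → cong ([ Z ⊆ S ] *_) (ℤP.*-comm (transform u Z) (transform v Z)))

  mass-+ˡ : ∀ u u′ v → mass S (u +ᶠ u′) v ≡ mass S u v + mass S u′ v
  mass-+ˡ u u′ v = trans (∑-cong n expand) (∑-+ n _ _)
    where
    expand : ∀ Z → [ Z ⊆ S ] * (transform (u +ᶠ u′) Z * transform v Z) ≡
             [ Z ⊆ S ] * (transform u Z * transform v Z) + [ Z ⊆ S ] * (transform u′ Z * transform v Z)
    expand Z rewrite transform-+ u u′ Z = distrib [ Z ⊆ S ] (transform u Z) (transform u′ Z) (transform v Z)
      where
      distrib : ∀ i p p′ q → i * ((p + p′) * q) ≡ i * (p * q) + i * (p′ * q)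
      distrib = solve-∀

  mass-+ʳ : ∀ u v v′ → mass S u (v +ᶠ v′) ≡ mass S u v + mass S u v′
  mass-+ʳ u v v′ = begin
    mass S u (v +ᶠ v′)        ≡⟨ mass-comm u (v +ᶠ v′) ⟩
    mass S (v +ᶠ v′) u        ≡⟨ mass-+ˡ v v′ u ⟩
    mass S v u + mass S v′ u  ≡⟨ cong₂ _+_ (mass-comm v u) (mass-comm v′ u) ⟩
    mass S u v + mass S u v′  ∎
    where open ≡-Reasoning

  mass-· : ∀ c d u v → mass S (c ·ᶠ u) (d ·ᶠ v) ≡ c * d * mass S u v
  mass-· c d u v = trans (∑-cong n pull) (∑-*ˡ n (c * d) _)
    where
    pull : ∀ Z → [ Z ⊆ S ] * (transform (c ·ᶠ u) Z * transform (d ·ᶠ v) Z) ≡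
           c * d * ([ Z ⊆ S ] * (transform u Z * transform v Z))
    pull Z rewrite transform-· c u Z | transform-· d v Z = rearrange [ Z ⊆ S ] c d (transform u Z) (transform v Z)
      where
      rearrange : ∀ i c d p q → i * (c * p * (d * q)) ≡ c * d * (i * (p * q))
      rearrange = solve-∀

  mass-nonneg : ∀ u → + 0 ℤ.≤ mass S u u
  mass-nonneg u = ∑-nonneg n _ (λ Z → indicator-square (does (Z ⊆? S)) (transform u Z))
    where
    indicator-square : ∀ b i → + 0 ℤ.≤ indicator b * (i * i)
    indicator-square false i = ℤP.≤-refl
    indicator-square true  i = subst (+ 0 ℤ.≤_) (sym (ℤP.*-identityˡ (i * i))) (square-nonneg i)
      where
      square-nonneg : ∀ i → + 0 ℤ.≤ i * i
      square-nonneg (+ k)       = subst (+ 0 ℤ.≤_) (ℤP.pos-* k k) (ℤ.+≤+ ℕ.z≤n)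
      square-nonneg ℤ.-[1+ k ]  = ℤ.+≤+ ℕ.z≤n

transform-one-balanced : ∀ {n} {u : Fun n} → ∑ n u ≡ + 0 → ∀ Z → transform one Z * transform u Z ≡ + 0
transform-one-balanced {n} {u} ∑u≡0 Z with ∑-χ Z
... | inj₁ refl = trans (cong (transform {n} one ∅ *_) u-at-∅) (ℤP.*-zeroʳ (transform {n} one ∅))
  where
  u-at-∅ : transform u ∅ ≡ + 0
  u-at-∅ = trans (∑-cong n (λ x → trans (cong (u x *_) (χ-∅ x)) (ℤP.*-identityʳ (u x)))) ∑u≡0
... | inj₂ ∑χ≡0 = trans (cong (_* transform u Z) one-at-Z) (ℤP.*-zeroˡ (transform u Z))
  where
  one-at-Z : transform one Z ≡ + 0
  one-at-Z = trans (∑-cong n (λ x → ℤP.*-identityˡ (χ Z x))) ∑χ≡0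

mass-one-balanced : ∀ {n} (S : Subset n) {u : Fun n} → ∑ n u ≡ + 0 → mass S one u ≡ + 0
mass-one-balanced {n} S {u} ∑u≡0 = trans (∑-cong n vanish) (∑-zero n)
  where
  vanish : ∀ Z → [ Z ⊆ S ] * (transform one Z * transform u Z) ≡ + 0
  vanish Z = trans (cong ([ Z ⊆ S ] *_) (transform-one-balanced ∑u≡0 Z))
                   (ℤP.*-zeroʳ [ Z ⊆ S ])

mass-balanced-one : ∀ {n} (S : Subset n) {u : Fun n} → ∑ n u ≡ + 0 → mass S u one ≡ + 0
mass-balanced-one S {u} ∑u≡0 = trans (mass-comm S u one) (mass-one-balanced S ∑u≡0)

mass-one : ∀ n (S : Subset n) → mass S one one ≡ + (4 ^ n)
mass-one zero    []      = refl
mass-one (suc n) (s ∷ S) = begin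
  mass (s ∷ S) one one                      ≡⟨ mass-⊗ {1} (s ∷ S) one one one one ⟩
  mass (s ∷ []) one one * mass S one one    ≡⟨ cong₂ _*_ (mass-one-coordinate s) (mass-one n S) ⟩
  + 4 * + (4 ^ n)                           ≡⟨ sym (ℤP.pos-* 4 (4 ^ n)) ⟩
  + (4 ^ suc n)                             ∎
  where
  open ≡-Reasoning
  mass-one-coordinate : ∀ s → mass (s ∷ []) one one ≡ + 4
  mass-one-coordinate outside = refl
  mass-one-coordinate inside  = refl

mass-split : ∀ {a b} (S : Subset (a ℕ.+ b)) (u : Fun a) → ∑ a u ≡ + 0 → (φ φ′ ψ ψ′ : Fun b) →
             mass S (u ⊗ φ +ᶠ one ⊗ ψ) (u ⊗ φ′ +ᶠ one ⊗ ψ′) ≡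
             mass (take a S) u u * mass (drop a S) φ φ′ + mass (take a S) one one * mass (drop a S) ψ ψ′
mass-split {a} S u ∑u≡0 φ φ′ ψ ψ′ = begin
  mass S (u ⊗ φ +ᶠ one ⊗ ψ) (u ⊗ φ′ +ᶠ one ⊗ ψ′)
    ≡⟨ mass-+ˡ S (u ⊗ φ) (one ⊗ ψ) (u ⊗ φ′ +ᶠ one ⊗ ψ′) ⟩
  mass S (u ⊗ φ) (u ⊗ φ′ +ᶠ one ⊗ ψ′) + mass S (one ⊗ ψ) (u ⊗ φ′ +ᶠ one ⊗ ψ′)
    ≡⟨ cong₂ _+_ (mass-+ʳ S (u ⊗ φ) (u ⊗ φ′) (one ⊗ ψ′)) (mass-+ʳ S (one ⊗ ψ) (u ⊗ φ′) (one ⊗ ψ′)) ⟩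
  (mass S (u ⊗ φ) (u ⊗ φ′) + mass S (u ⊗ φ) (one ⊗ ψ′)) +
  (mass S (one ⊗ ψ) (u ⊗ φ′) + mass S (one ⊗ ψ) (one ⊗ ψ′))
    ≡⟨ cong₂ _+_ (cong₂ _+_ (mass-⊗ S u u φ φ′) (mass-⊗ S u one φ ψ′))
                 (cong₂ _+_ (mass-⊗ S one u ψ φ′) (mass-⊗ S one one ψ ψ′)) ⟩
  (mass S₁ u u * mass S₂ φ φ′ + mass S₁ u one * mass S₂ φ ψ′) +
  (mass S₁ one u * mass S₂ ψ φ′ + mass S₁ one one * mass S₂ ψ ψ′)
    ≡⟨ cong₂ (λ p q → (mass S₁ u u * mass S₂ φ φ′ + p * mass S₂ φ ψ′) + (q * mass S₂ ψ φ′ + mass S₁ one one * mass S₂ ψ ψ′))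
             (mass-balanced-one S₁ ∑u≡0) (mass-one-balanced S₁ ∑u≡0) ⟩
  (mass S₁ u u * mass S₂ φ φ′ + + 0 * mass S₂ φ ψ′) + (+ 0 * mass S₂ ψ φ′ + mass S₁ one one * mass S₂ ψ ψ′)
    ≡⟨ drop-zeros (mass S₁ u u * mass S₂ φ φ′) (mass S₂ φ ψ′) (mass S₂ ψ φ′) (mass S₁ one one * mass S₂ ψ ψ′) ⟩
  mass S₁ u u * mass S₂ φ φ′ + mass S₁ one one * mass S₂ ψ ψ′
    ∎
  where
  open ≡-Reasoning
  S₁ = take a S
  S₂ = drop a S
  drop-zeros : ∀ p x y q → (p + + 0 * x) + (+ 0 * y + q) ≡ p + q
  drop-zeros = solve-∀

-- Recursive majority

maj3-expansion : ∀ p q r → + 2 * sign (maj3 p q r) ≡ sign p + sign q + sign r - sign p * sign q * sign r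
maj3-expansion false false false = refl
maj3-expansion false false true  = refl
maj3-expansion false true  false = refl
maj3-expansion false true  true  = refl
maj3-expansion true  false false = refl
maj3-expansion true  false true  = refl
maj3-expansion true  true  false = refl
maj3-expansion true  true  true  = refl

module _ {A : Set} (m : ℕ) where

  block₁ block₂ block₃ : Vec A (m ℕ.+ (m ℕ.+ (m ℕ.+ 0))) → Vec A m
  block₁ x = take m x
  block₂ x = take m (drop m x)
  block₃ x = take m (drop m (drop m x))

-- twiceMaj g = g₁ (1 − g₂ g₃) + (g₂ + g₃) on the three blocks, nested so that every summand is a tensor
-- product whose first factor is g or 1; for ±1-valued g it is 2·Maj₃ of the blocks (twiceMaj-apply).
module Majority {m} (g : Fun m) where

  1ₘ : Fun m
  1ₘ = one

  1₀ : Fun 0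
  1₀ = one

  φ : Fun (m ℕ.+ (m ℕ.+ 0))
  φ = g ⊗ -1ℤ ·ᶠ (g ⊗ 1₀) +ᶠ 1ₘ ⊗ (1ₘ ⊗ 1₀)

  ψ : Fun (m ℕ.+ (m ℕ.+ 0))
  ψ = g ⊗ (1ₘ ⊗ 1₀) +ᶠ 1ₘ ⊗ (g ⊗ 1₀)

  twiceMaj : Fun (m ℕ.+ (m ℕ.+ (m ℕ.+ 0)))
  twiceMaj = g ⊗ φ +ᶠ 1ₘ ⊗ ψ

  twiceMaj-apply : ∀ x → twiceMaj x ≡ g (block₁ m x) + g (block₂ m x) + g (block₃ m x)
                                    - g (block₁ m x) * g (block₂ m x) * g (block₃ m x)
  twiceMaj-apply x = regroup (g (block₁ m x)) (g (block₂ m x)) (g (block₃ m x))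
    where
    regroup : ∀ a b c → a * (b * (-1ℤ * (c * + 1)) + + 1 * (+ 1 * + 1)) + + 1 * (b * (+ 1 * + 1) + + 1 * (c * + 1))
                        ≡ a + b + c - a * b * c
    regroup = solve-∀

  twiceMaj-balanced : ∑ m g ≡ + 0 → ∑ (m ℕ.+ (m ℕ.+ (m ℕ.+ 0))) twiceMaj ≡ + 0
  twiceMaj-balanced ∑g≡0 =
    trans (∑-+ _ (g ⊗ φ) (1ₘ ⊗ ψ)) (cong₂ _+_ (∑-⊗-zeroˡ g φ ∑g≡0) (∑-⊗-zeroʳ 1ₘ ψ ∑ψ≡0))
    where
    ∑ψ≡0 : ∑ (m ℕ.+ (m ℕ.+ 0)) ψ ≡ + 0
    ∑ψ≡0 = trans (∑-+ _ (g ⊗ (1ₘ ⊗ 1₀)) (1ₘ ⊗ (g ⊗ 1₀)))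
                 (cong₂ _+_ (∑-⊗-zeroˡ g (1ₘ ⊗ 1₀) ∑g≡0) (∑-⊗-zeroʳ 1ₘ (g ⊗ 1₀) (∑-⊗-zeroˡ g 1₀ ∑g≡0)))

  module _ (∑g≡0 : ∑ m g ≡ + 0) (S : Subset (m ℕ.+ (m ℕ.+ (m ℕ.+ 0)))) where

    private
      S₂₃ = drop m S
      S₃′ = drop m S₂₃
      M₁ = mass (block₁ m S) g g
      M₂ = mass (block₂ m S) g g
      M₃ = mass (block₃ m S) g g
      W = + (4 ^ m)

      mass-⊗1₀ : ∀ (T : Subset (m ℕ.+ 0)) u v → mass T (u ⊗ 1₀) (v ⊗ 1₀) ≡ mass (take m T) u v
      mass-⊗1₀ T u v = trans (mass-⊗ T u v 1₀ 1₀)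
                             (trans (cong (mass (take m T) u v *_) (mass-one 0 (drop m T))) (ℤP.*-identityʳ _))

      mass-φ : mass S₂₃ φ φ ≡ M₂ * M₃ + W * W
      mass-φ = begin
        mass S₂₃ φ φ
          ≡⟨ mass-split S₂₃ g ∑g≡0 (-1ℤ ·ᶠ (g ⊗ 1₀)) (-1ℤ ·ᶠ (g ⊗ 1₀)) (1ₘ ⊗ 1₀) (1ₘ ⊗ 1₀) ⟩
        M₂ * mass S₃′ (-1ℤ ·ᶠ (g ⊗ 1₀)) (-1ℤ ·ᶠ (g ⊗ 1₀)) + mass (block₂ m S) 1ₘ 1ₘ * mass S₃′ (1ₘ ⊗ 1₀) (1ₘ ⊗ 1₀)
          ≡⟨ cong₂ (λ p q → M₂ * p + q * mass S₃′ (1ₘ ⊗ 1₀) (1ₘ ⊗ 1₀))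
                   (trans (mass-· S₃′ -1ℤ -1ℤ (g ⊗ 1₀) (g ⊗ 1₀)) (ℤP.*-identityˡ _)) (mass-one m (block₂ m S)) ⟩
        M₂ * mass S₃′ (g ⊗ 1₀) (g ⊗ 1₀) + W * mass S₃′ (1ₘ ⊗ 1₀) (1ₘ ⊗ 1₀)
          ≡⟨ cong₂ (λ p q → M₂ * p + W * q) (mass-⊗1₀ S₃′ g g)
                   (trans (mass-⊗1₀ S₃′ 1ₘ 1ₘ) (mass-one m (block₃ m S))) ⟩
        M₂ * M₃ + W * W
          ∎
        where open ≡-Reasoning

      mass-ψ : mass S₂₃ ψ ψ ≡ M₂ * W + W * M₃
      mass-ψ = begin
        mass S₂₃ ψ ψ
          ≡⟨ mass-split S₂₃ g ∑g≡0 (1ₘ ⊗ 1₀) (1ₘ ⊗ 1₀) (g ⊗ 1₀) (g ⊗ 1₀) ⟩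
        M₂ * mass S₃′ (1ₘ ⊗ 1₀) (1ₘ ⊗ 1₀) + mass (block₂ m S) 1ₘ 1ₘ * mass S₃′ (g ⊗ 1₀) (g ⊗ 1₀)
          ≡⟨ cong₂ (λ p q → M₂ * p + q * mass S₃′ (g ⊗ 1₀) (g ⊗ 1₀))
                   (trans (mass-⊗1₀ S₃′ 1ₘ 1ₘ) (mass-one m (block₃ m S))) (mass-one m (block₂ m S)) ⟩
        M₂ * W + W * mass S₃′ (g ⊗ 1₀) (g ⊗ 1₀)
          ≡⟨ cong (λ p → M₂ * W + W * p) (mass-⊗1₀ S₃′ g g) ⟩
        M₂ * W + W * M₃
          ∎
        where open ≡-Reasoning

    mass-twiceMaj : mass S twiceMaj twiceMaj ≡ M₁ * (M₂ * M₃ + W * W) + W * (M₂ * W + W * M₃)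
    mass-twiceMaj = begin
      mass S twiceMaj twiceMaj
        ≡⟨ mass-split S g ∑g≡0 φ φ ψ ψ ⟩
      M₁ * mass S₂₃ φ φ + mass (block₁ m S) 1ₘ 1ₘ * mass S₂₃ ψ ψ
        ≡⟨ cong₂ (λ p q → M₁ * p + q) mass-φ (cong₂ _*_ (mass-one m (block₁ m S)) mass-ψ) ⟩
      M₁ * (M₂ * M₃ + W * W) + W * (M₂ * W + W * M₃)
        ∎
      where open ≡-Reasoning

majSign : ∀ k → Fun (3 ^ k)
majSign k x = sign (majIter k x)

majSign-suc : ∀ k x → + 2 * majSign (suc k) x ≡ Majority.twiceMaj (majSign k) x
majSign-suc k x = trans (maj3-expansion (majIter k (block₁ m x)) (majIter k (block₂ m x)) (majIter k (block₃ m x)))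
                        (sym (Majority.twiceMaj-apply (majSign k) x))
  where m = 3 ^ k

majSign-balanced : ∀ k → ∑ (3 ^ k) (majSign k) ≡ + 0
majSign-balanced zero    = refl
majSign-balanced (suc k) = ℤP.*-cancelˡ-≡ (+ 2) (∑ N g′) (+ 0) (begin
  + 2 * ∑ N g′                     ≡⟨ sym (∑-*ˡ N (+ 2) g′) ⟩
  ∑ N (λ x → + 2 * g′ x)           ≡⟨ ∑-cong N (majSign-suc k) ⟩
  ∑ N (Majority.twiceMaj (majSign k)) ≡⟨ Majority.twiceMaj-balanced (majSign k) (majSign-balanced k) ⟩
  + 0                              ∎)
  where
  open ≡-Reasoning
  N = 3 ^ suc k
  g′ = majSign (suc k)

mass-majSign-suc : ∀ k (S : Subset (3 ^ suc k)) →
                   + 4 * mass S (majSign (suc k)) (majSign (suc k)) ≡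
                   mass S (Majority.twiceMaj (majSign k)) (Majority.twiceMaj (majSign k))
mass-majSign-suc k S = begin
  + 4 * mass S g′ g′                                  ≡⟨ sym (mass-· S (+ 2) (+ 2) g′ g′) ⟩
  mass S ((+ 2) ·ᶠ g′) ((+ 2) ·ᶠ g′)                  ≡⟨ mass-cong S (majSign-suc k) (majSign-suc k) ⟩
  mass S (Majority.twiceMaj g) (Majority.twiceMaj g)  ∎
  where
  open ≡-Reasoning
  g = majSign k
  g′ = majSign (suc k)

+∣mass∣ : ∀ {n} (S : Subset n) u → + ℤ.∣ mass S u u ∣ ≡ mass S u u
+∣mass∣ S u = ℤP.0≤i⇒+∣i∣≡i (mass-nonneg S u)

∣∣-split : ∀ a {b} (S : Subset (a ℕ.+ b)) → ∣ S ∣ ≡ ∣ take a S ∣ ℕ.+ ∣ drop a S ∣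
∣∣-split zero    S             = refl
∣∣-split (suc a) (inside ∷ S)  = cong suc (∣∣-split a S)
∣∣-split (suc a) (outside ∷ S) = ∣∣-split a S

∣∣-blocks : ∀ m (S : Subset (m ℕ.+ (m ℕ.+ (m ℕ.+ 0)))) → ∣ S ∣ ≡ ∣ block₁ m S ∣ ℕ.+ (∣ block₂ m S ∣ ℕ.+ ∣ block₃ m S ∣)
∣∣-blocks m S = begin
  ∣ S ∣                                                         ≡⟨ ∣∣-split m S ⟩
  ∣ block₁ m S ∣ ℕ.+ ∣ drop m S ∣                               ≡⟨ cong (∣ block₁ m S ∣ ℕ.+_) (∣∣-split m (drop m S)) ⟩
  ∣ block₁ m S ∣ ℕ.+ (∣ block₂ m S ∣ ℕ.+ ∣ drop m (drop m S) ∣)  ≡⟨ cong (λ r → ∣ block₁ m S ∣ ℕ.+ (∣ block₂ m S ∣ ℕ.+ r)) last ⟩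
  ∣ block₁ m S ∣ ℕ.+ (∣ block₂ m S ∣ ℕ.+ ∣ block₃ m S ∣)          ∎
  where
  open ≡-Reasoning
  ∣∣-empty : (T : Subset 0) → ∣ T ∣ ≡ 0
  ∣∣-empty [] = refl
  last : ∣ drop m (drop m S) ∣ ≡ ∣ block₃ m S ∣
  last = trans (∣∣-split m (drop m (drop m S)))
               (trans (cong (∣ block₃ m S ∣ ℕ.+_) (∣∣-empty (drop m (drop m (drop m S))))) (ℕP.+-identityʳ _))

pos-majorityRecursion : ∀ p₁ p₂ p₃ w →
  + (p₁ ℕ.* (p₂ ℕ.* p₃ ℕ.+ w ℕ.* w) ℕ.+ w ℕ.* (p₂ ℕ.* w ℕ.+ w ℕ.* p₃)) ≡
  + p₁ * (+ p₂ * + p₃ + + w * + w) + + w * (+ p₂ * + w + + w * + p₃)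
pos-majorityRecursion p₁ p₂ p₃ w = begin
  + (p₁ ℕ.* (p₂ ℕ.* p₃ ℕ.+ w ℕ.* w) ℕ.+ w ℕ.* (p₂ ℕ.* w ℕ.+ w ℕ.* p₃))
    ≡⟨ ℤP.pos-+ (p₁ ℕ.* (p₂ ℕ.* p₃ ℕ.+ w ℕ.* w)) (w ℕ.* (p₂ ℕ.* w ℕ.+ w ℕ.* p₃)) ⟩
  + (p₁ ℕ.* (p₂ ℕ.* p₃ ℕ.+ w ℕ.* w)) + + (w ℕ.* (p₂ ℕ.* w ℕ.+ w ℕ.* p₃))
    ≡⟨ cong₂ _+_ (ℤP.pos-* p₁ (p₂ ℕ.* p₃ ℕ.+ w ℕ.* w)) (ℤP.pos-* w (p₂ ℕ.* w ℕ.+ w ℕ.* p₃)) ⟩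
  + p₁ * + (p₂ ℕ.* p₃ ℕ.+ w ℕ.* w) + + w * + (p₂ ℕ.* w ℕ.+ w ℕ.* p₃)
    ≡⟨ cong₂ (λ x y → + p₁ * x + + w * y) (pos-sum-of-products p₂ p₃ w w) (pos-sum-of-products p₂ w w p₃) ⟩
  + p₁ * (+ p₂ * + p₃ + + w * + w) + + w * (+ p₂ * + w + + w * + p₃)
    ∎
  where
  open ≡-Reasoning
  pos-sum-of-products : ∀ a b c d → + (a ℕ.* b ℕ.+ c ℕ.* d) ≡ + a * + b + + c * + d
  pos-sum-of-products a b c d = trans (ℤP.pos-+ (a ℕ.* b) (c ℕ.* d)) (cong₂ _+_ (ℤP.pos-* a b) (ℤP.pos-* c d))

mass-bound : ∀ k (S : Subset (3 ^ k)) → 3 ^ k ℕ.* ℤ.∣ mass S (majSign k) (majSign k) ∣ ≤ ∣ S ∣ ℕ.* 4 ^ 3 ^ k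
mass-bound zero    (inside ∷ [])  = ℕP.≤-refl
mass-bound zero    (outside ∷ []) = ℕ.z≤n
mass-bound (suc k) S =
  subst₂ (λ s w³ → 3 ^ suc k ℕ.* p ≤ s ℕ.* w³) (sym (∣∣-blocks m S)) (sym (^-cube 4 m))
    (majority-step-bound m {{ℕP.m^n≢0 3 k}} recursion (mass-bound k S₁) (mass-bound k S₂) (mass-bound k S₃)
                         (∣p∣≤n S₁) (∣p∣≤n S₂) (∣p∣≤n S₃))
  where
  m = 3 ^ k
  S₁ = block₁ m S
  S₂ = block₂ m S
  S₃ = block₃ m S
  g = majSign k
  M : Subset m → ℤ
  M T = mass T g g
  p = ℤ.∣ mass S (majSign (suc k)) (majSign (suc k)) ∣
  p₁ = ℤ.∣ M S₁ ∣
  p₂ = ℤ.∣ M S₂ ∣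
  p₃ = ℤ.∣ M S₃ ∣
  w = 4 ^ m
  R : ℤ → ℤ → ℤ → ℤ
  R a b c = a * (b * c + + w * + w) + + w * (b * + w + + w * c)
  recursion : 4 ℕ.* p ≡ p₁ ℕ.* (p₂ ℕ.* p₃ ℕ.+ w ℕ.* w) ℕ.+ w ℕ.* (p₂ ℕ.* w ℕ.+ w ℕ.* p₃)
  recursion = ℤP.+-injective (begin
    + (4 ℕ.* p)                                         ≡⟨ ℤP.pos-* 4 p ⟩
    + 4 * + p                                           ≡⟨ cong (+ 4 *_) (+∣mass∣ S (majSign (suc k))) ⟩
    + 4 * mass S (majSign (suc k)) (majSign (suc k))    ≡⟨ mass-majSign-suc k S ⟩
    mass S (Majority.twiceMaj g) (Majority.twiceMaj g)  ≡⟨ Majority.mass-twiceMaj g (majSign-balanced k) S ⟩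
    R (M S₁) (M S₂) (M S₃)                              ≡⟨ cong (λ a → R a (M S₂) (M S₃)) (sym (+∣mass∣ S₁ g)) ⟩
    R (+ p₁) (M S₂) (M S₃)                              ≡⟨ cong₂ (R (+ p₁)) (sym (+∣mass∣ S₂ g)) (sym (+∣mass∣ S₃ g)) ⟩
    R (+ p₁) (+ p₂) (+ p₃)                              ≡⟨ sym (pos-majorityRecursion p₁ p₂ p₃ w) ⟩
    + (p₁ ℕ.* (p₂ ℕ.* p₃ ℕ.+ w ℕ.* w) ℕ.+ w ℕ.* (p₂ ℕ.* w ℕ.+ w ℕ.* p₃)) ∎)
    where open ≡-Reasoning

mass-bound-ℤ : ∀ k (S : Subset (3 ^ k)) →
               mass S (majSign k) (majSign k) * + (3 ^ k) ℤ.≤ + ∣ S ∣ * + (2 ^ 3 ^ k ℕ.* 2 ^ 3 ^ k)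
mass-bound-ℤ k S = subst₂ ℤ._≤_ (trans (ℤP.pos-* p (3 ^ k)) (cong (_* + (3 ^ k)) (+∣mass∣ S (majSign k))))
                                (ℤP.pos-* ∣ S ∣ (2 ^ n ℕ.* 2 ^ n)) (ℤ.+≤+ bound)
  where
  n = 3 ^ k
  p = ℤ.∣ mass S (majSign k) (majSign k) ∣
  bound : p ℕ.* 3 ^ k ≤ ∣ S ∣ ℕ.* (2 ^ n ℕ.* 2 ^ n)
  bound = subst₂ _≤_ (ℕP.*-comm (3 ^ k) p) (cong (∣ S ∣ ℕ.*_) (4^n≡2^n*2^n n)) (mass-bound k S)

-- From integer sums to rationals

sumℤ : List ℤ → ℤ
sumℤ = List.foldr _+_ (+ 0)

sumℤ-++ : ∀ xs ys → sumℤ (xs ++ ys) ≡ sumℤ xs + sumℤ ys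
sumℤ-++ []       ys = sym (ℤP.+-identityˡ (sumℤ ys))
sumℤ-++ (x ∷ xs) ys = trans (cong (_+_ x) (sumℤ-++ xs ys)) (sym (ℤP.+-assoc x (sumℤ xs) (sumℤ ys)))

sumℤ-filter : ∀ {A : Set} {p} {P : Pred A p} (P? : Decidable P) (h : A → ℤ) xs →
              sumℤ (map h (filter P? xs)) ≡ sumℤ (map (λ x → indicator (does (P? x)) * h x) xs)
sumℤ-filter P? h []       = refl
sumℤ-filter P? h (x ∷ xs) with does (P? x)
... | true  = cong₂ _+_ (sym (ℤP.*-identityˡ (h x))) (sumℤ-filter P? h xs)
... | false = trans (sumℤ-filter P? h xs) (sym (ℤP.+-identityˡ _))

toℚᵘ-/ : ∀ i n .{{_ : NonZero n}} → toℚᵘ (i ℚ./ n) ≃ i ℚᵘ./ n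
toℚᵘ-/ i (suc n) = ℚP.toℚᵘ-fromℚᵘ (mkℚᵘ i n)

/-*-/ : ∀ i j m n .{{_ : NonZero m}} .{{_ : NonZero n}} →
        (i ℚᵘ./ m) ℚᵘ.* (j ℚᵘ./ n) ≃ ((i * j) ℚᵘ./ (m ℕ.* n)) {{ℕP.m*n≢0 m n}}
/-*-/ i j (suc m) (suc n) = ℚᵘP.≃-refl

/-+-/ : ∀ i j d .{{_ : NonZero d}} → (i ℚᵘ./ d) ℚᵘ.+ (j ℚᵘ./ d) ≃ (i + j) ℚᵘ./ d
/-+-/ i j (suc e) = *≡* (trans (factor i j D) (cong ((i + j) *_) (sym (ℤP.pos-* (suc e) (suc e)))))
  where
  D = + suc e
  factor : ∀ i j D → (i * D + j * D) * D ≡ (i + j) * (D * D)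
  factor = solve-∀

/-≤-/ : ∀ {i j} m n .{{_ : NonZero m}} .{{_ : NonZero n}} → i * + n ℤ.≤ j * + m → i ℚᵘ./ m ℚᵘ.≤ j ℚᵘ./ n
/-≤-/ (suc m) (suc n) = *≤*

toℚᵘ-sum-squares : ∀ {A : Set} (t : A → ℤ) d .{{_ : NonZero d}} xs →
                   toℚᵘ (sumℚ (map (λ z → (t z ℚ./ d) ℚ.* (t z ℚ./ d)) xs)) ≃
                   (sumℤ (map (λ z → t z * t z) xs) ℚᵘ./ (d ℕ.* d)) {{ℕP.m*n≢0 d d}}
toℚᵘ-sum-squares t (suc e) [] = *≡* refl
toℚᵘ-sum-squares t d (z ∷ xs) = begin
  toℚᵘ (q ℚ.* q ℚ.+ rest)
    ≈⟨ ℚP.toℚᵘ-homo-+ (q ℚ.* q) rest ⟩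
  toℚᵘ (q ℚ.* q) ℚᵘ.+ toℚᵘ rest
    ≈⟨ ℚᵘP.+-cong (ℚᵘP.≃-trans (ℚP.toℚᵘ-homo-* q q) (ℚᵘP.*-cong (toℚᵘ-/ (t z) d) (toℚᵘ-/ (t z) d)))
                  (toℚᵘ-sum-squares t d xs) ⟩
  (t z ℚᵘ./ d) ℚᵘ.* (t z ℚᵘ./ d) ℚᵘ.+ R ℚᵘ./ (d ℕ.* d)
    ≈⟨ ℚᵘP.+-congˡ (R ℚᵘ./ (d ℕ.* d)) (/-*-/ (t z) (t z) d d) ⟩
  (t z * t z) ℚᵘ./ (d ℕ.* d) ℚᵘ.+ R ℚᵘ./ (d ℕ.* d)
    ≈⟨ /-+-/ (t z * t z) R (d ℕ.* d) ⟩
  (t z * t z + R) ℚᵘ./ (d ℕ.* d)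
    ∎
  where
  open ℚᵘP.≃-Reasoning
  instance _ = ℕP.m*n≢0 d d
  q = t z ℚ./ d
  rest = sumℚ (map (λ z → (t z ℚ./ d) ℚ.* (t z ℚ./ d)) xs)
  R = sumℤ (map (λ z → t z * t z) xs)

sumℤ-allVecs : ∀ n (h : Fun n) → sumℤ (map h (allVecs n)) ≡ ∑ n h
sumℤ-allVecs zero    h = ℤP.+-identityʳ (h [])
sumℤ-allVecs (suc n) h = begin
  sumℤ (map h (map (false ∷_) (allVecs n) ++ map (true ∷_) (allVecs n)))
    ≡⟨ cong sumℤ (ListP.map-++ h (map (false ∷_) (allVecs n)) (map (true ∷_) (allVecs n))) ⟩
  sumℤ (map h (map (false ∷_) (allVecs n)) ++ map h (map (true ∷_) (allVecs n)))
    ≡⟨ sumℤ-++ (map h (map (false ∷_) (allVecs n))) (map h (map (true ∷_) (allVecs n))) ⟩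
  sumℤ (map h (map (false ∷_) (allVecs n))) + sumℤ (map h (map (true ∷_) (allVecs n)))
    ≡⟨ cong₂ _+_ (half false) (half true) ⟩
  ∑ (suc n) h
    ∎
  where
  open ≡-Reasoning
  half : ∀ b → sumℤ (map h (map (b ∷_) (allVecs n))) ≡ ∑ n (h ∘ (b ∷_))
  half b = trans (cong sumℤ (sym (ListP.map-∘ (allVecs n)))) (sumℤ-allVecs n (h ∘ (b ∷_)))

sumℤ-V : ∀ {n} (S : Subset n) (h : Fun n) → sumℤ (map h (V S)) ≡ ∑ n (λ Z → [ Z ⊆ S ] * h Z)
sumℤ-V {n} S h = trans (sumℤ-filter (_⊆? S) h (allVecs n)) (sumℤ-allVecs n _)

2^n*2^n≢0 : ∀ n → NonZero (2 ^ n ℕ.* 2 ^ n)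
2^n*2^n≢0 n = ℕP.m*n≢0 (2 ^ n) (2 ^ n) {{ℕP.m^n≢0 2 n}} {{ℕP.m^n≢0 2 n}}

toℚᵘ-fourier-mass : ∀ {n} (f : Vec Bool n → Bool) (S : Subset n) →
                    toℚᵘ (sumℚ (map (λ Z → fourier f Z ℚ.* fourier f Z) (V S))) ≃
                    (mass S (sign ∘ f) (sign ∘ f) ℚᵘ./ (2 ^ n ℕ.* 2 ^ n)) {{2^n*2^n≢0 n}}
toℚᵘ-fourier-mass {n} f S =
  ℚᵘP.≃-trans (toℚᵘ-sum-squares t (2 ^ n) (V S)) (ℚᵘP.≃-reflexive (ℚᵘP./-cong numerator refl))
  where
  instance
    _ = ℕP.m^n≢0 2 n
    _ = 2^n*2^n≢0 n
  t : Vec Bool n → ℤ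
  t Z = sumℤ (map (λ x → sign (f x) * χ Z x) (allVecs n))
  numerator : sumℤ (map (λ Z → t Z * t Z) (V S)) ≡ mass S (sign ∘ f) (sign ∘ f)
  numerator = trans (sumℤ-V S (λ Z → t Z * t Z))
    (∑-cong n (λ Z → cong ([ Z ⊆ S ] *_) (cong₂ _*_ (sumℤ-allVecs n _) (sumℤ-allVecs n _))))

lemma4p3 : (k : ℕ) → 1 ≤ k → (S : Subset (3 ^ k)) →
    sumℚ (map (λ Z → fourier (majIter k) Z ℚ.* fourier (majIter k) Z) (V S)) ℚ.≤ ratio k S
lemma4p3 k _ S = ℚP.toℚᵘ-cancel-≤ (begin
  toℚᵘ (sumℚ (map (λ Z → fourier (majIter k) Z ℚ.* fourier (majIter k) Z) (V S)))
    ≃⟨ toℚᵘ-fourier-mass (majIter k) S ⟩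
  mass S (majSign k) (majSign k) ℚᵘ./ (2 ^ n ℕ.* 2 ^ n)
    ≤⟨ /-≤-/ (2 ^ n ℕ.* 2 ^ n) (3 ^ k) (mass-bound-ℤ k S) ⟩
  + ∣ S ∣ ℚᵘ./ 3 ^ k
    ≃⟨ toℚᵘ-/ (+ ∣ S ∣) (3 ^ k) ⟨
  toℚᵘ (ratio k S)
    ∎)
  where
  open ℚᵘP.≤-Reasoning
  n = 3 ^ k
  instance
    _ = ℕP.m^n≢0 3 k
    _ = 2^n*2^n≢0 n
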